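{- Let $D$ be a directed graph with vertices $s,t$, let $k,d$ be nonnegative integers and let $k'<k$. Let $P_1,\dots,P_{k'}\in\mathcal P(s,t)$ be paths such that $|P_i \triangle P_j| \ge 3^{k-j}d$ for all $1\le i<j\le k'$, and such that there is no path $P\in\mathcal P(s,t)$ with $|P\triangle P_j|\ge 3^{k-k'-1}d$ for all $1\le j\le k'$. Let $q = 3^{k-k'-1}d$ and, for $1 \le i \le k'$, let $\mathcal P_i = \{P \in \mathcal P(s, t) : |P \triangle P_i| < q\}$. Then for all $i\neq j$, every $P \in \mathcal P_i$ and every $P' \in \mathcal P_j$ satisfy $|P \triangle P'| \ge d$.
   Context: $\mathcal P(s,t)$ denotes the set of all directed paths from $s$ to $t$ in $D$. Paths are identified with their arc sets, so $P \triangle P'$ is the symmetric difference of the arc sets of $P$ and $P'$. -}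

module Defs where

open import Level using (Level; _⊔_) renaming (suc to lsuc)
open import Data.Nat using (ℕ; _+_)
open import Data.Product using (Σ; _×_; _,_)
open import Data.List using (List; []; _∷_; length; filter)
open import Data.List.Relation.Unary.Unique.Propositional using (Unique)
open import Data.List.Membership.DecPropositional using (_∈?_)
open import Data.Product.Properties using (≡-dec)
open import Relation.Nullary using (¬?)
open import Relation.Binary.Definitions using (DecidableEquality)

-- A directed graph: a vertex type with decidable equality and an arc
-- relation.  Arcs are identified by their (tail, head) pairs.
record Digraph (a b : Level) : Set (lsuc (a ⊔ b)) where
  field
    V    : Set a
    _≟V_ : DecidableEquality V
    Arc  : V → V → Set b

module _ {a b : Level} (D : Digraph a b) where
  open Digraph D

  data Walk : V → V → Set (a ⊔ b) where
    nil  : ∀ {v} → Walk v v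
    cons : ∀ {u v w} → Arc u v → Walk v w → Walk u w

  vertices : ∀ {u w} → Walk u w → List V
  vertices (nil {v})  = v ∷ []
  vertices (cons {u} _ p) = u ∷ vertices p

  arcs : ∀ {u w} → Walk u w → List (V × V)
  arcs nil = []
  arcs (cons {u} {v} _ p) = (u , v) ∷ arcs p

  Path : V → V → Set (a ⊔ b)
  Path s t = Σ (Walk s t) (λ p → Unique (vertices p))

  arcSet : ∀ {s t} → Path s t → List (V × V)
  arcSet (p , _) = arcs p

  private
    _≟A_ : DecidableEquality (V × V)
    _≟A_ = ≡-dec _≟V_ _≟V_

  -- |P △ P'| : number of arcs lying in exactly one of the two arc sets
  -- (arc lists of paths have no duplicates, so this is the cardinality).
  symDiff : ∀ {s t s' t'} → Path s t → Path s' t' → ℕ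
  symDiff P Q =
    length (filter (λ e → ¬? (_∈?_ _≟A_ e (arcSet Q))) (arcSet P))
    + length (filter (λ e → ¬? (_∈?_ _≟A_ e (arcSet P))) (arcSet Q))

{-# OPTIONS --safe #-}
-- The number of arcs in the symmetric difference is a pseudometric on 𝒫(s,t)
-- (the arc list of a path has no repeats, which gives the triangle
-- inequality).  With q = 3^(k-k'-1) d and i < j ≤ k', the separation of
-- P_i and P_j is at least 3^(k-j) d ≥ 3q, so two paths within distance q of
-- P_i and of P_j respectively are at distance more than 3q - 2q = q ≥ d.
module Submission where

open import Defs
open import Level using (Level)
open import Data.Nat using (ℕ; suc; _*_; _∸_; _^_; _≤_; _<_; _≥_)
open import Data.Fin using (Fin; toℕ)
open import Data.Product using (Σ)
open import Relation.Nullary using (¬_)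
open import Relation.Binary.PropositionalEquality using (_≢_)

open import Data.Nat using (_+_; s<s)
open import Data.Nat.Properties
open import Algebra.Properties.CommutativeSemigroup +-commutativeSemigroup using (interchange)
open import Data.Fin using (zero; suc) renaming (_<_ to _<ᶠ_)
open import Data.Fin.Properties using (injective⇒≤)
import Data.Fin.Properties as Fin
open import Data.List using (List; []; _∷_; _++_; length; filter; lookup)
open import Data.List.Properties using (length-++)
import Data.List.Relation.Unary.All as All
open import Data.List.Relation.Unary.AllPairs using ([]; _∷_)
import Data.List.Relation.Unary.Any as Any
open import Data.List.Relation.Unary.Any using (here; there)
open import Data.List.Relation.Unary.Unique.Propositional using (Unique)
import Data.List.Relation.Unary.Unique.Propositional.Properties as Unique
open import Data.List.Relation.Binary.Subset.Propositional using (_⊆_)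
open import Data.List.Membership.Propositional using (_∈_)
open import Data.List.Membership.Propositional.Properties
  using (∈-lookup; ∈-filter⁺; ∈-filter⁻; ∈-++⁺ˡ; ∈-++⁺ʳ)
open import Data.List.Membership.Setoid.Properties using (index-injective)
open import Data.Product using (_,_)
open import Data.Product.Properties using (≡-dec)
open import Function.Definitions using (Injective)
open import Relation.Binary.Definitions using (DecidableEquality; Tri; tri<; tri≈; tri>)
open import Relation.Binary.PropositionalEquality
  using (_≡_; refl; sym; trans; cong; subst; setoid)
open import Relation.Nullary using (yes; no; ¬?; contradiction)

module _ {a} {A : Set a} where

  Unique-lookup-injective : ∀ {xs : List A} → Unique xs →
                            ∀ i j → lookup xs i ≡ lookup xs j → i ≡ j
  Unique-lookup-injective (_ ∷ _)       zero    zero    _  = refl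
  Unique-lookup-injective (x≢xs ∷ _)    zero    (suc j) eq = contradiction eq (All.lookup x≢xs (∈-lookup j))
  Unique-lookup-injective (x≢xs ∷ _)    (suc i) zero    eq = contradiction (sym eq) (All.lookup x≢xs (∈-lookup i))
  Unique-lookup-injective (_ ∷ xs-uniq) (suc i) (suc j) eq = cong suc (Unique-lookup-injective xs-uniq i j eq)

  Unique-⊆⇒length≤ : ∀ {xs ys : List A} → Unique xs → xs ⊆ ys → length xs ≤ length ys
  Unique-⊆⇒length≤ {xs} {ys} xs-uniq xs⊆ys = injective⇒≤ position-injective
    where
    position : Fin (length xs) → Fin (length ys)
    position i = Any.index (xs⊆ys (∈-lookup i))

    position-injective : Injective _≡_ _≡_ position
    position-injective {i} {j} eq = Unique-lookup-injective xs-uniq i j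
      (index-injective (setoid A) (xs⊆ys (∈-lookup i)) (xs⊆ys (∈-lookup j)) eq)

module SymmetricDifference {a} {A : Set a} (_≟_ : DecidableEquality A) where
  open import Data.List.Membership.DecPropositional _≟_ using (_∈?_)

  _∖_ : List A → List A → List A
  xs ∖ ys = filter (λ x → ¬? (x ∈? ys)) xs

  ∣_△_∣ : List A → List A → ℕ
  ∣ xs △ ys ∣ = length (xs ∖ ys) + length (ys ∖ xs)

  △-sym : ∀ xs ys → ∣ xs △ ys ∣ ≡ ∣ ys △ xs ∣
  △-sym xs ys = +-comm (length (xs ∖ ys)) (length (ys ∖ xs))

  ∖-⊆-∖++∖ : ∀ xs ys zs → xs ∖ zs ⊆ (xs ∖ ys) ++ (ys ∖ zs)
  ∖-⊆-∖++∖ xs ys zs {x} x∈xs∖zs with ∈-filter⁻ (λ x → ¬? (x ∈? zs)) {xs = xs} x∈xs∖zs | x ∈? ys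
  ... | x∈xs , x∉zs | yes x∈ys = ∈-++⁺ʳ (xs ∖ ys) (∈-filter⁺ (λ x → ¬? (x ∈? zs)) x∈ys x∉zs)
  ... | x∈xs , _    | no x∉ys  = ∈-++⁺ˡ (∈-filter⁺ (λ x → ¬? (x ∈? ys)) x∈xs x∉ys)

  length-∖-triangle : ∀ {xs} ys zs → Unique xs →
                      length (xs ∖ zs) ≤ length (xs ∖ ys) + length (ys ∖ zs)
  length-∖-triangle {xs} ys zs xs-uniq = begin
    length (xs ∖ zs)                   ≤⟨ Unique-⊆⇒length≤ (Unique.filter⁺ _ xs-uniq) (∖-⊆-∖++∖ xs ys zs) ⟩
    length ((xs ∖ ys) ++ (ys ∖ zs))    ≡⟨ length-++ (xs ∖ ys) ⟩
    length (xs ∖ ys) + length (ys ∖ zs) ∎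
    where open ≤-Reasoning

  △-triangle : ∀ {xs} ys {zs} → Unique xs → Unique zs →
               ∣ xs △ zs ∣ ≤ ∣ xs △ ys ∣ + ∣ ys △ zs ∣
  △-triangle {xs} ys {zs} xs-uniq zs-uniq = begin
    length (xs ∖ zs) + length (zs ∖ xs)
      ≤⟨ +-mono-≤ (length-∖-triangle ys zs xs-uniq) (length-∖-triangle ys xs zs-uniq) ⟩
    (length (xs ∖ ys) + length (ys ∖ zs)) + (length (zs ∖ ys) + length (ys ∖ xs))
      ≡⟨ cong (length (xs ∖ ys) + length (ys ∖ zs) +_) (+-comm (length (zs ∖ ys)) (length (ys ∖ xs))) ⟩
    (length (xs ∖ ys) + length (ys ∖ zs)) + (length (ys ∖ xs) + length (zs ∖ ys))
      ≡⟨ interchange (length (xs ∖ ys)) _ _ _ ⟩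
    ∣ xs △ ys ∣ + ∣ ys △ zs ∣ ∎
    where open ≤-Reasoning

module _ {a b : Level} (D : Digraph a b) where
  open Digraph D
  open SymmetricDifference (≡-dec _≟V_ _≟V_)

  tail∈vertices : ∀ {u w x y} (p : Walk D u w) → (x , y) ∈ arcs D p → x ∈ vertices D p
  tail∈vertices (cons _ p) (here refl) = here refl
  tail∈vertices (cons _ p) (there xy∈p) = there (tail∈vertices p xy∈p)

  arcs-unique : ∀ {u w} (p : Walk D u w) → Unique (vertices D p) → Unique (arcs D p)
  arcs-unique nil        _                     = []
  arcs-unique (cons _ p) (u≢vertices ∷ p-uniq) =
    All.tabulate (λ uv∈p uv≡e → All.lookup u≢vertices
                   (tail∈vertices p (subst (_∈ arcs D p) (sym uv≡e) uv∈p)) refl)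
    ∷ arcs-unique p p-uniq

  arcSet-unique : ∀ {s t} (P : Path D s t) → Unique (arcSet D P)
  arcSet-unique (p , p-uniq) = arcs-unique p p-uniq

  symDiff-sym : ∀ {s t s′ t′} (P : Path D s t) (Q : Path D s′ t′) →
                symDiff D P Q ≡ symDiff D Q P
  symDiff-sym P Q = △-sym (arcSet D P) (arcSet D Q)

  symDiff-triangle : ∀ {s t s′ t′ s″ t″} (P : Path D s t) (Q : Path D s′ t′) (R : Path D s″ t″) →
                     symDiff D P R ≤ symDiff D P Q + symDiff D Q R
  symDiff-triangle P Q R = △-triangle (arcSet D Q) (arcSet-unique P) (arcSet-unique R)

  balls-apart : ∀ {s t} {q} (P P′ Q Q′ : Path D s t) → 3 * q ≤ symDiff D P P′ →
                symDiff D Q P < q → symDiff D Q′ P′ < q → q ≤ symDiff D Q Q′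
  balls-apart {q = q} P P′ Q Q′ 3q≤PP′ QP<q Q′P′<q = ≮⇒≥ λ QQ′<q → <⇒≱ (begin-strict
    symDiff D P P′                                    ≤⟨ symDiff-triangle P Q P′ ⟩
    symDiff D P Q + symDiff D Q P′                    ≤⟨ +-monoʳ-≤ (symDiff D P Q) (symDiff-triangle Q Q′ P′) ⟩
    symDiff D P Q + (symDiff D Q Q′ + symDiff D Q′ P′) ≡⟨ cong (_+ (symDiff D Q Q′ + symDiff D Q′ P′)) (symDiff-sym P Q) ⟩
    symDiff D Q P + (symDiff D Q Q′ + symDiff D Q′ P′) <⟨ +-mono-< QP<q (+-mono-< QQ′<q (<-≤-trans Q′P′<q (m≤m+n q 0))) ⟩
    3 * q                                             ∎) 3q≤PP′
    where open ≤-Reasoning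

exponent-gap : ∀ {j k′ k} → j < k′ → k′ < k → suc (k ∸ k′ ∸ 1) ≤ k ∸ suc j
exponent-gap {j} {k′} {k} j<k′ k′<k = begin
  suc (k ∸ k′ ∸ 1) ≡⟨ cong suc (trans (∸-+-assoc k k′ 1) (cong (k ∸_) (+-comm k′ 1))) ⟩
  suc (k ∸ suc k′) ≤⟨ ∸-monoʳ-< (s<s j<k′) k′<k ⟩
  k ∸ suc j        ∎
  where open ≤-Reasoning

thrice-radius≤separation : ∀ {j k′ k} d → j < k′ → k′ < k → 3 * (3 ^ (k ∸ k′ ∸ 1) * d) ≤ 3 ^ (k ∸ suc j) * d
thrice-radius≤separation {j} {k′} {k} d j<k′ k′<k = begin
  3 * (3 ^ (k ∸ k′ ∸ 1) * d) ≡⟨ *-assoc 3 (3 ^ (k ∸ k′ ∸ 1)) d ⟨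
  3 ^ suc (k ∸ k′ ∸ 1) * d   ≤⟨ *-monoˡ-≤ d (^-monoʳ-≤ 3 (exponent-gap j<k′ k′<k)) ⟩
  3 ^ (k ∸ suc j) * d        ∎
  where open ≤-Reasoning

lemma11 : ∀ {a b : Level} (D : Digraph a b) (s t : Digraph.V D)
          (k d k′ : ℕ) → k′ < k
          → (P : Fin k′ → Path D s t)
          → (∀ (i j : Fin k′) → toℕ i < toℕ j
               → symDiff D (P i) (P j) ≥ 3 ^ (k ∸ suc (toℕ j)) * d)
          → ¬ (Σ (Path D s t) (λ Q → ∀ (j : Fin k′)
                 → symDiff D Q (P j) ≥ 3 ^ (k ∸ k′ ∸ 1) * d))
          → ∀ (i j : Fin k′) → i ≢ j
          → ∀ (Q Q′ : Path D s t)
          → symDiff D Q (P i) < 3 ^ (k ∸ k′ ∸ 1) * d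
          → symDiff D Q′ (P j) < 3 ^ (k ∸ k′ ∸ 1) * d
          → symDiff D Q Q′ ≥ d
lemma11 D s t k d k′ k′<k P separated _ i j i≢j Q Q′ QPᵢ<q Q′Pⱼ<q =
  ≤-trans d≤q (apart (Fin.<-cmp i j))
  where
  q : ℕ
  q = 3 ^ (k ∸ k′ ∸ 1) * d

  d≤q : d ≤ q
  d≤q = m≤n*m d (3 ^ (k ∸ k′ ∸ 1)) {{m^n≢0 3 (k ∸ k′ ∸ 1)}}

  separated-by-3q : ∀ {i j : Fin k′} → toℕ i < toℕ j → 3 * q ≤ symDiff D (P i) (P j)
  separated-by-3q {i} {j} i<j = ≤-trans (thrice-radius≤separation d (Fin.toℕ<n j) k′<k) (separated i j i<j)

  apart : Tri (i <ᶠ j) (i ≡ j) (j <ᶠ i) → q ≤ symDiff D Q Q′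
  apart (tri< i<j _ _) = balls-apart D (P i) (P j) Q Q′ (separated-by-3q i<j) QPᵢ<q Q′Pⱼ<q
  apart (tri≈ _ i≡j _) = contradiction i≡j i≢j
  apart (tri> _ _ j<i) = subst (q ≤_) (symDiff-sym D Q′ Q)
    (balls-apart D (P j) (P i) Q′ Q (separated-by-3q j<i) Q′Pⱼ<q QPᵢ<q)
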